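{- For $n\ge 4$ with $n\ne 6$, the unidirectional cycle $\overrightarrow{C_n}$ is $\{0,3\}$-antimagic.
   Context: The unidirectional cycle $\overrightarrow{C_n}$ has vertices $v_1,\dots,v_n$ and arcs $(v_i,v_{i+1})$ for $1\le i\le n-1$ and $(v_n,v_1)$, so $d(v_i,v_j)=(j-i)\bmod n$, where $d(u,y)$ is the length of a shortest directed path. $N_D(v)=\{y:d(v,y)\in D\}$; a bijection $f:V\to\{1,\dots,n\}$ is $D$-antimagic if $\omega_D(v)=\sum_{y\in N_D(v)}f(y)$ are pairwise distinct; the graph is $D$-antimagic if such a bijection exists. -}

module Defs where

open import Data.Nat using (ℕ; zero; suc; _+_; _∸_; NonZero)
open import Data.Nat.DivMod using (_%_)
open import Data.Fin using (Fin; toℕ)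
open import Data.List using (List; map; filter; allFin)
open import Data.Nat.ListAction using (sum)
open import Data.List.Relation.Unary.Any using (any?)
open import Data.Nat.Properties using (_≟_)
open import Relation.Binary.PropositionalEquality using (_≡_)
open import Function.Bundles using (_↔_; Inverse)
open import Function.Definitions using (Injective)

-- Vertex v_{i+1} of the unidirectional cycle C_n is represented by i : Fin n.
-- Directed distance d(v_i, v_j) = (j - i) mod n, computed as (j + n - i) mod n.
dist : (n : ℕ) → .{{_ : NonZero n}} → Fin n → Fin n → ℕ
dist n i j = (toℕ j + n ∸ toℕ i) % n

-- Weight ω_D(v) = Σ_{y : d(v,y) ∈ D} f(y), for a distance set D given as a list.
-- The labelling f : V → {1,…,n} is given as a bijection g : Fin n ↔ Fin n,
-- with f(y) = toℕ (g y) + 1.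
weight : (n : ℕ) → .{{_ : NonZero n}} → List ℕ → (Fin n ↔ Fin n) → Fin n → ℕ
weight n D g v =
  sum (map (λ y → suc (toℕ (Inverse.to g y)))
           (filter (λ y → any? (λ d → dist n v y ≟ d) D) (allFin n)))

IsDAntimagicLabelling : (n : ℕ) → .{{_ : NonZero n}} → List ℕ → (Fin n ↔ Fin n) → Set
IsDAntimagicLabelling n D g = Injective _≡_ _≡_ (weight n D g)

record CycleDAntimagic (n : ℕ) .{{_ : NonZero n}} (D : List ℕ) : Set where
  field
    labelling : Fin n ↔ Fin n
    antimagic : IsDAntimagicLabelling n D labelling

-- For D = {0, 3} the weight of v is 2 + f(v) + f(v + 3), so it suffices to find a labelling for
-- which a ↦ f(a) + f(a + 3 mod n) is injective; injectivity is shown by a decoder recovering a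
-- from that sum.  For odd n the identity labelling works: the sum is 2a + 3, which is odd, unless
-- a + 3 wraps around, when it is 2a + 3 − n, which is even.  For even n ≥ 14 a rotation of the
-- labels of the last five vertices does the job, and the lengths 4, 8, 10, 12 are checked by
-- computation.
module Submission where

open import Defs
open import Data.Nat using (ℕ; zero; suc; _+_; _∸_; _≤_; _<_; NonZero; s≤s; z<s; s<s; pred)
open import Data.Nat.Properties
open import Data.Nat.DivMod using (_%_; _mod_; m<n⇒m%n≡m; [m+n]%n≡m%n; %-distribˡ-+; m%n%n≡m%n)
open import Data.Nat.ListAction using (sum)
open import Data.Nat.ListAction.Properties using (sum-↭)
open import Data.Nat.Tactic.RingSolver using (solve; solve-∀)
open import Data.Fin using (Fin; toℕ; fromℕ<; #_)
open import Data.Fin.Properties using (toℕ-fromℕ<; toℕ-injective; toℕ<n; all?)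
import Data.Fin.Properties as Fin
open import Data.List using (List; []; _∷_; map; filter; allFin)
open import Data.List.Properties using (map-∘)
open import Data.List.Relation.Unary.All as All using (All)
import Data.List.Relation.Unary.All.Properties as Allₚ
open import Data.List.Relation.Unary.Any using (any?)
open import Data.List.Relation.Unary.Unique.Propositional using (Unique)
open import Data.List.Relation.Unary.Unique.Propositional.Properties using (filter⁺; allFin⁺)
open import Data.List.Membership.Propositional using (_∈_)
open import Data.List.Membership.Propositional.Properties using (∈-map⁺; ∈-map⁻; ∈-filter⁺; ∈-filter⁻; ∈-allFin)
open import Data.List.Membership.Propositional.Properties.WithK using (unique∧set⇒bag)
open import Data.List.Relation.Binary.BagAndSetEquality using (_∼[_]_; set; ∼bag⇒↭)
open import Data.List.Relation.Binary.Permutation.Propositional.Properties using (map⁺)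
open import Data.Vec using (Vec; lookup)
open import Data.Product using (∃-syntax; _,_; proj₂)
open import Data.Sum using (_⊎_; inj₁; inj₂; [_,_])
open import Function.Base using (_∘_; id; const; _⟨_⟩_)
open import Function.Bundles using (_↔_; Inverse; mk⇔; mk↔ₛ′)
open import Function.Definitions using (Injective)
open import Relation.Nullary using (Dec; yes; no; contradiction; map′; _→-dec_)
open import Relation.Nullary.Decidable using (True; toWitness)
open import Relation.Unary using (Decidable)
open import Relation.Binary.Definitions using (tri<; tri≈; tri>)
open import Relation.Binary.PropositionalEquality
  using (_≡_; _≢_; refl; sym; trans; cong; cong₂; subst; module ≡-Reasoning)

sum-map-unique-set : {A : Set} (h : A → ℕ) {xs ys : List A} → Unique xs → Unique ys →
  xs ∼[ set ] ys → sum (map h xs) ≡ sum (map h ys)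
sum-map-unique-set h xs! ys! xs≈ys = sum-↭ (map⁺ h (∼bag⇒↭ (unique∧set⇒bag xs! ys! xs≈ys)))

module _ {n : ℕ} .{{_ : NonZero n}} where

  open import Data.List.Relation.Unary.All using ([]; _∷_)
  open import Data.List.Relation.Unary.AllPairs using ([]; _∷_)

  advance : ℕ → Fin n → Fin n
  advance d v = (d + toℕ v) mod n

  toℕ-advance : ∀ d v → toℕ (advance d v) ≡ (d + toℕ v) % n
  toℕ-advance d v = toℕ-fromℕ< _

  [m%n+o]%n≡[m+o]%n : ∀ m o → (m % n + o) % n ≡ (m + o) % n
  [m%n+o]%n≡[m+o]%n m o = begin
    (m % n + o) % n         ≡⟨ %-distribˡ-+ (m % n) o n ⟩
    (m % n % n + o % n) % n ≡⟨ cong (λ x → (x + o % n) % n) (m%n%n≡m%n m n) ⟩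
    (m % n + o % n) % n     ≡⟨ %-distribˡ-+ m o n ⟨
    (m + o) % n             ∎
    where open ≡-Reasoning

  [m+n]%n≡m : ∀ {m} → m < n → (m + n) % n ≡ m
  [m+n]%n≡m {m} m<n = trans ([m+n]%n≡m%n m n) (m<n⇒m%n≡m m<n)

  advance-dist : ∀ v y → advance (dist n v y) v ≡ y
  advance-dist v y = toℕ-injective (begin
    toℕ (advance (dist n v y) v)   ≡⟨ toℕ-advance _ v ⟩
    ((b + n ∸ a) % n + a) % n      ≡⟨ [m%n+o]%n≡[m+o]%n (b + n ∸ a) a ⟩
    (b + n ∸ a + a) % n            ≡⟨ cong (_% n) (m∸n+n≡m a≤b+n) ⟩
    (b + n) % n                    ≡⟨ [m+n]%n≡m (toℕ<n y) ⟩
    b                              ∎)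
    where
    open ≡-Reasoning
    a = toℕ v
    b = toℕ y
    a≤b+n : a ≤ b + n
    a≤b+n = ≤-trans (<⇒≤ (toℕ<n v)) (m≤n+m n b)

  dist-advance : ∀ {d} v → d < n → dist n v (advance d v) ≡ d
  dist-advance {d} v d<n =
    trans (cong (λ b → (b + n ∸ toℕ v) % n) (toℕ-advance d v)) (distℕ≡d (toℕ<n v))
    where
    open ≡-Reasoning
    distℕ≡d : ∀ {a} → a < n → ((d + a) % n + n ∸ a) % n ≡ d
    distℕ≡d {a} a<n with d + a <? n
    ... | yes d+a<n = begin
      ((d + a) % n + n ∸ a) % n ≡⟨ cong (λ b → (b + n ∸ a) % n) (m<n⇒m%n≡m d+a<n) ⟩
      (d + a + n ∸ a) % n       ≡⟨ cong (_% n) (+-∸-comm n (m≤n+m a d)) ⟩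
      (d + a ∸ a + n) % n       ≡⟨ cong (λ x → (x + n) % n) (m+n∸n≡m d a) ⟩
      (d + n) % n               ≡⟨ [m+n]%n≡m d<n ⟩
      d                         ∎
    ... | no d+a≮n = begin
      ((d + a) % n + n ∸ a) % n ≡⟨ cong (λ x → (x % n + n ∸ a) % n) (sym c+n≡d+a) ⟩
      ((c + n) % n + n ∸ a) % n ≡⟨ cong (λ b → (b + n ∸ a) % n) ([m+n]%n≡m c<n) ⟩
      (c + n ∸ a) % n           ≡⟨ cong (λ x → (x ∸ a) % n) c+n≡d+a ⟩
      (d + a ∸ a) % n           ≡⟨ cong (_% n) (m+n∸n≡m d a) ⟩
      d % n                     ≡⟨ m<n⇒m%n≡m d<n ⟩
      d                         ∎
      where
      c = d + a ∸ n
      c+n≡d+a : c + n ≡ d + a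
      c+n≡d+a = m∸n+n≡m (≮⇒≥ d+a≮n)
      c<n : c < n
      c<n = +-cancelʳ-< n c n (subst (_< n + n) (sym c+n≡d+a) (+-mono-< d<n a<n))

  advance-injective : ∀ v {d e} → d < n → e < n → advance d v ≡ advance e v → d ≡ e
  advance-injective v {d} {e} d<n e<n eq = begin
    d                         ≡⟨ dist-advance v d<n ⟨
    dist n v (advance d v)    ≡⟨ cong (dist n v) eq ⟩
    dist n v (advance e v)    ≡⟨ dist-advance v e<n ⟩
    e                         ∎
    where open ≡-Reasoning

  advance-zero : ∀ v → advance 0 v ≡ v
  advance-zero v = toℕ-injective (trans (toℕ-advance 0 v) (m<n⇒m%n≡m (toℕ<n v)))

  advances-unique : ∀ v {D} → All (_< n) D → Unique D → Unique (map (λ d → advance d v) D)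
  advances-unique v []          []          = []
  advances-unique v (d<n ∷ D<n) (d∉D ∷ D!) =
    Allₚ.map⁺ (All.zipWith (λ (d≢e , e<n) → d≢e ∘ advance-injective v d<n e<n) (d∉D , D<n))
    ∷ advances-unique v D<n D!

  distIn? : (v : Fin n) (D : List ℕ) → Decidable (λ y → dist n v y ∈ D)
  distIn? v D y = any? (λ d → dist n v y ≟ d) D

  neighbourhood∼advances : ∀ v {D} → All (_< n) D →
    filter (distIn? v D) (allFin n) ∼[ set ] map (λ d → advance d v) D
  neighbourhood∼advances v {D} D<n = mk⇔ to from
    where
    to : ∀ {y} → y ∈ filter (distIn? v D) (allFin n) → y ∈ map (λ d → advance d v) D
    to {y} y∈N = subst (_∈ map (λ d → advance d v) D) (advance-dist v y)
      (∈-map⁺ (λ d → advance d v) (proj₂ (∈-filter⁻ (distIn? v D) {xs = allFin n} y∈N)))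
    from : ∀ {y} → y ∈ map (λ d → advance d v) D → y ∈ filter (distIn? v D) (allFin n)
    from y∈ with ∈-map⁻ (λ d → advance d v) y∈
    ... | d , d∈D , refl = ∈-filter⁺ (distIn? v D) (∈-allFin _)
      (subst (_∈ D) (sym (dist-advance v (All.lookup D<n d∈D))) d∈D)

  label : (Fin n ↔ Fin n) → Fin n → ℕ
  label g y = suc (toℕ (Inverse.to g y))

  weight≡sum-over-distances : ∀ g v {D} → All (_< n) D → Unique D →
    weight n D g v ≡ sum (map (λ d → label g (advance d v)) D)
  weight≡sum-over-distances g v {D} D<n D! = begin
    sum (map (label g) (filter (distIn? v D) (allFin n)))
      ≡⟨ sum-map-unique-set (label g) (filter⁺ (distIn? v D) (allFin⁺ n))
           (advances-unique v D<n D!) (neighbourhood∼advances v D<n) ⟩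
    sum (map (label g) (map (λ d → advance d v) D))
      ≡⟨ cong sum (map-∘ D) ⟨
    sum (map (λ d → label g (advance d v)) D) ∎
    where open ≡-Reasoning

  weight-0∷3 : 3 < n → ∀ g v →
    weight n (0 ∷ 3 ∷ []) g v ≡ 2 + (toℕ (Inverse.to g v) + toℕ (Inverse.to g (advance 3 v)))
  weight-0∷3 3<n g v = begin
    weight n (0 ∷ 3 ∷ []) g v
      ≡⟨ weight≡sum-over-distances g v (<-trans z<s 3<n ∷ 3<n ∷ []) (((λ ()) ∷ []) ∷ [] ∷ []) ⟩
    label g (advance 0 v) + (label g w + 0)
      ≡⟨ cong₂ (λ x y → label g x + y) (advance-zero v) (+-identityʳ (label g w)) ⟩
    suc (toℕ (Inverse.to g v)) + label g w
      ≡⟨ cong suc (+-suc _ _) ⟩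
    2 + (toℕ (Inverse.to g v) + toℕ (Inverse.to g w)) ∎
    where
    open ≡-Reasoning
    w = advance 3 v

-- Labellings are built as mutually inverse maps of ℕ preserving [0, n), to avoid arithmetic in Fin n.
record PermutationBelow (n : ℕ) : Set where
  field
    to      : ℕ → ℕ
    from    : ℕ → ℕ
    to-<    : ∀ {x} → x < n → to x < n
    from-<  : ∀ {y} → y < n → from y < n
    from-to : ∀ {x} → x < n → from (to x) ≡ x
    to-from : ∀ {y} → y < n → to (from y) ≡ y

  ↔Fin : Fin n ↔ Fin n
  ↔Fin = mk↔ₛ′ (λ x → fromℕ< (to-< (toℕ<n x))) (λ y → fromℕ< (from-< (toℕ<n y)))
    (λ y → toℕ-injective (trans (toℕ-fromℕ< _) (trans (cong to (toℕ-fromℕ< _)) (to-from (toℕ<n y)))))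
    (λ x → toℕ-injective (trans (toℕ-fromℕ< _) (trans (cong from (toℕ-fromℕ< _)) (from-to (toℕ<n x)))))

  toℕ-↔Fin : ∀ x → toℕ (Inverse.to ↔Fin x) ≡ to (toℕ x)
  toℕ-↔Fin x = toℕ-fromℕ< _

pairSum : ∀ {n} .{{_ : NonZero n}} → PermutationBelow n → ℕ → ℕ
pairSum {n} π a = to a + to ((3 + a) % n)
  where open PermutationBelow π

antimagic-by-decoding : ∀ {n} .{{_ : NonZero n}} → 3 < n → (π : PermutationBelow n) (decode : ℕ → ℕ) →
  (∀ {a} → a < n → decode (pairSum π a) ≡ a) → CycleDAntimagic n (0 ∷ 3 ∷ [])
antimagic-by-decoding {n} 3<n π decode decode-pairSum = record
  { labelling = ↔Fin
  ; antimagic = λ {v} {w} ωv≡ωw → toℕ-injective (begin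
      toℕ v                           ≡⟨ decode-pairSum (toℕ<n v) ⟨
      decode (pairSum π (toℕ v))      ≡⟨ cong decode (pairSum-weight v) ⟨
      decode (weight n D ↔Fin v ∸ 2)  ≡⟨ cong (λ ω → decode (ω ∸ 2)) ωv≡ωw ⟩
      decode (weight n D ↔Fin w ∸ 2)  ≡⟨ cong decode (pairSum-weight w) ⟩
      decode (pairSum π (toℕ w))      ≡⟨ decode-pairSum (toℕ<n w) ⟩
      toℕ w                           ∎)
  }
  where
  open ≡-Reasoning
  open PermutationBelow π
  D = 0 ∷ 3 ∷ []
  pairSum-weight : ∀ v → weight n D ↔Fin v ∸ 2 ≡ pairSum π (toℕ v)
  pairSum-weight v = trans (cong (_∸ 2) (weight-0∷3 3<n ↔Fin v))
    (cong₂ _+_ (toℕ-↔Fin v) (trans (toℕ-↔Fin (advance 3 v)) (cong to (toℕ-advance 3 v))))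

halve : ℕ → ℕ ⊎ ℕ
halve zero    = inj₁ zero
halve (suc x) = [ inj₂ , inj₁ ∘ suc ] (halve x)

halve-double     : ∀ h → halve (h + h) ≡ inj₁ h
halve-suc-double : ∀ h → halve (suc (h + h)) ≡ inj₂ h
halve-double zero    = refl
halve-double (suc h) rewrite +-suc h h | halve-suc-double h = refl
halve-suc-double h rewrite halve-double h = refl

byParity : (ℕ → ℕ) → (ℕ → ℕ) → ℕ → ℕ
byParity onEven onOdd x = [ onEven , onOdd ] (halve x)

byParity-double : ∀ onEven onOdd {x} h → x ≡ h + h → byParity onEven onOdd x ≡ onEven h
byParity-double onEven onOdd h refl = cong [ onEven , onOdd ] (halve-double h)

byParity-suc-double : ∀ onEven onOdd {x} h → x ≡ suc (h + h) → byParity onEven onOdd x ≡ onOdd h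
byParity-suc-double onEven onOdd h refl = cong [ onEven , onOdd ] (halve-suc-double h)

piecewise : ℕ → (ℕ → ℕ) → (ℕ → ℕ) → ℕ → ℕ
piecewise c below above x with x <? c
... | yes _ = below x
... | no  _ = above x

piecewise-< : ∀ {c} below above {x} → x < c → piecewise c below above x ≡ below x
piecewise-< {c} below above {x} x<c with x <? c
... | yes _   = refl
... | no  x≮c = contradiction x<c x≮c

piecewise-≥ : ∀ {c} below above {x} → c ≤ x → piecewise c below above x ≡ above x
piecewise-≥ {c} below above {x} c≤x with x <? c
... | yes x<c = contradiction c≤x (<⇒≱ x<c)
... | no  _   = refl

idPermutation : ∀ n → PermutationBelow n
idPermutation n = record
  { to = id ; from = id ; to-< = id ; from-< = id ; from-to = λ _ → refl ; to-from = λ _ → refl }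

module WindowRotation {m k : ℕ} (m≤k : m ≤ k) where

  rotate unrotate : ℕ → ℕ
  rotate   = piecewise m id (piecewise (suc m) (const k) pred)
  unrotate = piecewise m id (piecewise k suc (const m))

  rotate-< : ∀ {x} → x < m → rotate x ≡ x
  rotate-< = piecewise-< _ _

  rotate-≡ : rotate m ≡ k
  rotate-≡ = trans (piecewise-≥ {m} id _ ≤-refl) (piecewise-< {suc m} (const k) pred ≤-refl)

  rotate-> : ∀ {x} → m < x → rotate x ≡ pred x
  rotate-> m<x = trans (piecewise-≥ _ _ (<⇒≤ m<x)) (piecewise-≥ _ _ m<x)

  unrotate-< : ∀ {y} → y < m → unrotate y ≡ y
  unrotate-< = piecewise-< _ _

  unrotate-mid : ∀ {y} → m ≤ y → y < k → unrotate y ≡ suc y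
  unrotate-mid m≤y y<k = trans (piecewise-≥ _ _ m≤y) (piecewise-< _ _ y<k)

  unrotate-top : unrotate k ≡ m
  unrotate-top = trans (piecewise-≥ {m} id _ m≤k) (piecewise-≥ {k} suc (const m) ≤-refl)

  permutation : PermutationBelow (suc k)
  permutation = record
    { to = rotate ; from = unrotate ; to-< = to-< ; from-< = from-< ; from-to = from-to ; to-from = to-from }
    where
    to-< : ∀ {x} → x < suc k → rotate x < suc k
    to-< {x} x≤k with <-cmp x m
    ... | tri< x<m _ _  = subst (_< suc k) (sym (rotate-< x<m)) x≤k
    ... | tri≈ _ refl _ = subst (_< suc k) (sym rotate-≡) ≤-refl
    ... | tri> _ _ m<x  = subst (_< suc k) (sym (rotate-> m<x)) (≤-<-trans pred[n]≤n x≤k)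
    from-< : ∀ {y} → y < suc k → unrotate y < suc k
    from-< {y} y≤k with m ≤? y | k ≤? y
    ... | no  m≰y | _       = subst (_< suc k) (sym (unrotate-< (≰⇒> m≰y))) y≤k
    ... | yes m≤y | no  k≰y = subst (_< suc k) (sym (unrotate-mid m≤y (≰⇒> k≰y))) (s≤s (≰⇒> k≰y))
    ... | yes _   | yes k≤y with ≤-antisym (≤-pred y≤k) k≤y
    ...   | refl = subst (_< suc k) (sym unrotate-top) (s≤s m≤k)
    from-to : ∀ {x} → x < suc k → unrotate (rotate x) ≡ x
    from-to {x} x≤k with <-cmp x m
    ... | tri< x<m _ _  = trans (cong unrotate (rotate-< x<m)) (unrotate-< x<m)
    ... | tri≈ _ refl _ = trans (cong unrotate rotate-≡) unrotate-top
    ... | tri> _ _ m<x  = from-to-above m<x x≤k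
      where
      from-to-above : ∀ {x} → m < x → x < suc k → unrotate (rotate x) ≡ x
      from-to-above {suc x} (s≤s m≤x) (s≤s x<k) =
        trans (cong unrotate (rotate-> (s≤s m≤x))) (unrotate-mid m≤x x<k)
    to-from : ∀ {y} → y < suc k → rotate (unrotate y) ≡ y
    to-from {y} y≤k with m ≤? y | k ≤? y
    ... | no  m≰y | _       = trans (cong rotate (unrotate-< (≰⇒> m≰y))) (rotate-< (≰⇒> m≰y))
    ... | yes m≤y | no  k≰y = trans (cong rotate (unrotate-mid m≤y (≰⇒> k≰y))) (rotate-> (s≤s m≤y))
    ... | yes _   | yes k≤y with ≤-antisym (≤-pred y≤k) k≤y
    ...   | refl = trans (cong rotate unrotate-top) rotate-≡

[m+o]+[n+o]≡m+n+[o+o] : ∀ m n o → (m + o) + (n + o) ≡ (m + n) + (o + o)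
[m+o]+[n+o]≡m+n+[o+o] = solve-∀

sum-shifted-odd : ∀ c d h x → c + d ≡ suc (h + h) → (c + x) + (d + x) ≡ suc ((h + x) + (h + x))
sum-shifted-odd c d h x c+d≡ = begin
  (c + x) + (d + x)       ≡⟨ [m+o]+[n+o]≡m+n+[o+o] c d x ⟩
  (c + d) + (x + x)       ≡⟨ cong (_+ (x + x)) c+d≡ ⟩
  suc ((h + h) + (x + x)) ≡⟨ cong suc ([m+o]+[n+o]≡m+n+[o+o] h h x) ⟨
  suc ((h + x) + (h + x)) ∎
  where open ≡-Reasoning

sum-shifted-even : ∀ c d h x → c + d ≡ h + h → (c + x) + (d + x) ≡ (h + x) + (h + x)
sum-shifted-even c d h x c+d≡ = begin
  (c + x) + (d + x)       ≡⟨ [m+o]+[n+o]≡m+n+[o+o] c d x ⟩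
  (c + d) + (x + x)       ≡⟨ cong (_+ (x + x)) c+d≡ ⟩
  (h + h) + (x + x)       ≡⟨ [m+o]+[n+o]≡m+n+[o+o] h h x ⟨
  (h + x) + (h + x)       ∎
  where open ≡-Reasoning

module OddLength (j : ℕ) where
  n = 5 + (j + j)

  fromEven fromOdd decode : ℕ → ℕ
  fromEven h = h + j + 1
  fromOdd    = pred
  decode     = byParity fromEven fromOdd

  decode-pairSum : ∀ {a} → a < n → decode (pairSum (idPermutation n) a) ≡ a
  decode-pairSum {a} a<n with 3 + a <? n
  ... | yes 3+a<n = begin
    decode (a + (3 + a) % n) ≡⟨ cong (λ b → decode (a + b)) (m<n⇒m%n≡m 3+a<n) ⟩
    decode (a + (3 + a))     ≡⟨ byParity-suc-double fromEven fromOdd (suc a) (sum-shifted-odd 0 3 1 a refl) ⟩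
    a                        ∎
    where open ≡-Reasoning
  ... | no 3+a≮n with m≤n⇒∃[o]m+o≡n (≮⇒≥ 3+a≮n)
  ...   | t , n+t≡3+a with +-cancelˡ-≡ 3 (2 + (j + j) + t) a n+t≡3+a
  ...     | refl = begin
    decode (a + (n + t) % n) ≡⟨ cong (λ b → decode (a + b)) (trans (cong (_% n) (+-comm n t)) ([m+n]%n≡m t<n)) ⟩
    decode (a + t)           ≡⟨ byParity-double fromEven fromOdd {a + t} (1 + j + t) (solve (j ∷ t ∷ [])) ⟩
    1 + j + t + j + 1        ≡⟨ solve (j ∷ t ∷ []) ⟩
    a                        ∎
    where
    open ≡-Reasoning
    t<n : t < n
    t<n = ≤-<-trans (m≤n+m t (2 + (j + j))) a<n

  antimagic : CycleDAntimagic n (0 ∷ 3 ∷ [])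
  antimagic = antimagic-by-decoding (m≤m+n 4 (1 + (j + j))) (idPermutation n) decode decode-pairSum

-- Rotating the labels of the vertices 9 + J, …, 13 + J (9 + J ↦ 13 + J, x ↦ x − 1), the sum for
-- a < 6 + J stays 2a + 3, and for a = c + J with c = 6, …, 13 it is, in order,
-- 19 + 2J, 16 + 2J, 18 + 2J, 24 + 2J, 21 + 2J, 10 + J, 12 + J, 14 + J.
module EvenLength (j : ℕ) where
  J = j + j
  n = 14 + J

  open WindowRotation {9 + J} {13 + J} (m≤n+m (9 + J) 4)

  fromOdd fromEven decode : ℕ → ℕ
  fromOdd  = piecewise (7 + J) pred (piecewise (10 + J) (_∸ 3) id)
  fromEven = piecewise (8 + J) (_+ (6 + j)) (piecewise (10 + J) pred (_∸ 3))
  decode   = byParity fromEven fromOdd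

  fromOdd-low : ∀ {h} → h < 7 + J → fromOdd h ≡ pred h
  fromOdd-low = piecewise-< _ _
  fromOdd-mid : ∀ {h} → 7 + J ≤ h → h < 10 + J → fromOdd h ≡ h ∸ 3
  fromOdd-mid 7+J≤h h<10+J = trans (piecewise-≥ _ _ 7+J≤h) (piecewise-< _ _ h<10+J)
  fromOdd-high : ∀ {h} → 10 + J ≤ h → fromOdd h ≡ h
  fromOdd-high 10+J≤h = trans (piecewise-≥ {7 + J} _ _ (≤-trans (m≤n+m (7 + J) 3) 10+J≤h)) (piecewise-≥ _ _ 10+J≤h)

  fromEven-low : ∀ {h} → h < 8 + J → fromEven h ≡ h + (6 + j)
  fromEven-low = piecewise-< _ _
  fromEven-mid : ∀ {h} → 8 + J ≤ h → h < 10 + J → fromEven h ≡ pred h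
  fromEven-mid 8+J≤h h<10+J = trans (piecewise-≥ _ _ 8+J≤h) (piecewise-< _ _ h<10+J)
  fromEven-high : ∀ {h} → 10 + J ≤ h → fromEven h ≡ h ∸ 3
  fromEven-high 10+J≤h = trans (piecewise-≥ {8 + J} _ _ (≤-trans (m≤n+m (8 + J) 2) 10+J≤h)) (piecewise-≥ _ _ 10+J≤h)

  sum-wrapped : ∀ c t h → c + t ≡ h + h → (c + J) + t ≡ (h + j) + (h + j)
  sum-wrapped c t h c+t≡ = begin
    (c + J) + t       ≡⟨ +-assoc c J t ⟩
    c + (J + t)       ≡⟨ cong (c +_) (+-comm J t) ⟩
    c + (t + J)       ≡⟨ +-assoc c t J ⟨
    (c + t) + J       ≡⟨ cong (_+ J) c+t≡ ⟩
    (h + h) + J       ≡⟨ [m+o]+[n+o]≡m+n+[o+o] h h j ⟨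
    (h + j) + (h + j) ∎
    where open ≡-Reasoning

  fromEven-wrapped : ∀ c → c < 8 → fromEven (c + j) ≡ (c + 6) + J
  fromEven-wrapped c c<8 = trans (fromEven-low (+-mono-<-≤ c<8 (m≤m+n j j))) ([m+o]+[n+o]≡m+n+[o+o] c 6 j)

  decodes-odd : ∀ {a b} h → (3 + a) % n ≡ b → rotate a + rotate b ≡ suc (h + h) → fromOdd h ≡ a →
    decode (pairSum permutation a) ≡ a
  decodes-odd h refl sum≡ = trans (byParity-suc-double fromEven fromOdd h sum≡)

  decodes-even : ∀ {a b} h → (3 + a) % n ≡ b → rotate a + rotate b ≡ h + h → fromEven h ≡ a →
    decode (pairSum permutation a) ≡ a
  decodes-even h refl sum≡ = trans (byParity-double fromEven fromOdd h sum≡)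

  exceptional : ∀ o → o < 8 → decode (pairSum permutation (o + (6 + J))) ≡ o + (6 + J)
  exceptional 0 _ = decodes-odd (9 + J) (m<n⇒m%n≡m (m<n+m (9 + J) {5} z<s))
    (cong₂ _+_ (rotate-< (m<n+m (6 + J) {3} z<s)) rotate-≡ ⟨ trans ⟩ sum-shifted-odd 6 13 9 J refl)
    (fromOdd-mid (m≤n+m (7 + J) 2) (n<1+n (9 + J)))
  exceptional 1 _ = decodes-even (8 + J) (m<n⇒m%n≡m (m<n+m (10 + J) {4} z<s))
    (cong₂ _+_ (rotate-< (m<n+m (7 + J) {2} z<s)) (rotate-> (n<1+n (9 + J))) ⟨ trans ⟩ sum-shifted-even 7 9 8 J refl)
    (fromEven-mid ≤-refl (m<n+m (8 + J) {2} z<s))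
  exceptional 2 _ = decodes-even (9 + J) (m<n⇒m%n≡m (m<n+m (11 + J) {3} z<s))
    (cong₂ _+_ (rotate-< (n<1+n (8 + J))) (rotate-> (m<n+m (9 + J) {2} z<s)) ⟨ trans ⟩ sum-shifted-even 8 10 9 J refl)
    (fromEven-mid (m≤n+m (8 + J) 1) (n<1+n (9 + J)))
  exceptional 3 _ = decodes-even (12 + J) (m<n⇒m%n≡m (m<n+m (12 + J) {2} z<s))
    (cong₂ _+_ rotate-≡ (rotate-> (m<n+m (9 + J) {3} z<s)) ⟨ trans ⟩ sum-shifted-even 13 11 12 J refl)
    (fromEven-high (m≤n+m (10 + J) 2))
  exceptional 4 _ = decodes-odd (10 + J) (m<n⇒m%n≡m (n<1+n (13 + J)))
    (cong₂ _+_ (rotate-> (n<1+n (9 + J))) (rotate-> (m<n+m (9 + J) {4} z<s)) ⟨ trans ⟩ sum-shifted-odd 9 12 10 J refl)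
    (fromOdd-high ≤-refl)
  exceptional 5 _ = decodes-even (5 + j) ([m+n]%n≡m {n} {0} z<s)
    (cong₂ _+_ (rotate-> (m<n+m (9 + J) {2} z<s)) (rotate-< z<s) ⟨ trans ⟩ sum-wrapped 10 0 5 refl)
    (fromEven-wrapped 5 (m<n+m 5 {3} z<s))
  exceptional 6 _ = decodes-even (6 + j) ([m+n]%n≡m {n} {1} (s<s z<s))
    (cong₂ _+_ (rotate-> (m<n+m (9 + J) {3} z<s)) (rotate-< (s<s z<s)) ⟨ trans ⟩ sum-wrapped 11 1 6 refl)
    (fromEven-wrapped 6 (m<n+m 6 {2} z<s))
  exceptional 7 _ = decodes-even (7 + j) ([m+n]%n≡m {n} {2} (s<s (s<s z<s)))
    (cong₂ _+_ (rotate-> (m<n+m (9 + J) {4} z<s)) (rotate-< (s<s (s<s z<s))) ⟨ trans ⟩ sum-wrapped 12 2 7 refl)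
    (fromEven-wrapped 7 (n<1+n 7))
  exceptional (suc (suc (suc (suc (suc (suc (suc (suc o)))))))) 8+o<8 = contradiction (m≤m+n 8 o) (<⇒≱ 8+o<8)

  decode-pairSum : ∀ {a} → a < n → decode (pairSum permutation a) ≡ a
  decode-pairSum {a} a<n with a <? 6 + J
  ... | yes a<6+J = decodes-odd (suc a) (m<n⇒m%n≡m (<-trans 3+a<9+J (m<n+m (9 + J) {5} z<s)))
    (cong₂ _+_ (rotate-< (<-trans a<6+J (m<n+m (6 + J) {3} z<s))) (rotate-< 3+a<9+J) ⟨ trans ⟩ sum-shifted-odd 0 3 1 a refl)
    (fromOdd-low (s<s a<6+J))
    where
    3+a<9+J : 3 + a < 9 + J
    3+a<9+J = s<s (s<s (s<s a<6+J))
  ... | no a≮6+J with m≤n⇒∃[o]m+o≡n (≮⇒≥ a≮6+J)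
  ...   | o , refl = subst (λ a → decode (pairSum permutation a) ≡ a) (+-comm o (6 + J))
    (exceptional o (+-cancelʳ-< (6 + J) o 8 (subst (_< n) (+-comm (6 + J) o) a<n)))

  antimagic : CycleDAntimagic n (0 ∷ 3 ∷ [])
  antimagic = antimagic-by-decoding (m≤m+n 4 (10 + J)) permutation decode decode-pairSum

injective? : ∀ {k} (f : Fin k → ℕ) → Dec (Injective _≡_ _≡_ f)
injective? f = map′ (λ inj {x} {y} → inj x y) (λ inj x y → inj)
  (all? λ x → all? λ y → (f x ≟ f y) →-dec (x Fin.≟ y))

tabulated↔ : ∀ {k} (σ τ : Vec (Fin k) k) →
  {True (all? λ y → lookup σ (lookup τ y) Fin.≟ y)} → {True (all? λ x → lookup τ (lookup σ x) Fin.≟ x)} →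
  Fin k ↔ Fin k
tabulated↔ σ τ {στ} {τσ} = mk↔ₛ′ (lookup σ) (lookup τ) (toWitness στ) (toWitness τσ)

antimagic-by-computation : ∀ {k} .{{_ : NonZero k}} {D} (g : Fin k ↔ Fin k) →
  {True (injective? (weight k D g))} → CycleDAntimagic k D
antimagic-by-computation g {injective} = record { labelling = g ; antimagic = toWitness injective }

module SmallLengths where
  open import Data.Vec using ([]; _∷_)

  cycle4 : CycleDAntimagic 4 (0 ∷ 3 ∷ [])
  cycle4 = antimagic-by-computation (tabulated↔ (# 3 ∷ # 1 ∷ # 0 ∷ # 2 ∷ []) (# 2 ∷ # 1 ∷ # 3 ∷ # 0 ∷ []))

  cycle8 : CycleDAntimagic 8 (0 ∷ 3 ∷ [])
  cycle8 = antimagic-by-computation (tabulated↔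
    (# 2 ∷ # 3 ∷ # 6 ∷ # 0 ∷ # 5 ∷ # 4 ∷ # 1 ∷ # 7 ∷ [])
    (# 3 ∷ # 6 ∷ # 0 ∷ # 1 ∷ # 5 ∷ # 4 ∷ # 2 ∷ # 7 ∷ []))

  cycle10 : CycleDAntimagic 10 (0 ∷ 3 ∷ [])
  cycle10 = antimagic-by-computation (tabulated↔
    (# 8 ∷ # 0 ∷ # 7 ∷ # 9 ∷ # 1 ∷ # 4 ∷ # 6 ∷ # 5 ∷ # 3 ∷ # 2 ∷ [])
    (# 1 ∷ # 4 ∷ # 9 ∷ # 8 ∷ # 5 ∷ # 7 ∷ # 6 ∷ # 2 ∷ # 0 ∷ # 3 ∷ []))

  cycle12 : CycleDAntimagic 12 (0 ∷ 3 ∷ [])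
  cycle12 = antimagic-by-computation (tabulated↔
    (# 9 ∷ # 2 ∷ # 3 ∷ # 10 ∷ # 0 ∷ # 6 ∷ # 4 ∷ # 7 ∷ # 5 ∷ # 8 ∷ # 11 ∷ # 1 ∷ [])
    (# 4 ∷ # 11 ∷ # 1 ∷ # 2 ∷ # 6 ∷ # 8 ∷ # 5 ∷ # 7 ∷ # 9 ∷ # 0 ∷ # 3 ∷ # 10 ∷ []))

even-or-odd : ∀ x → ∃[ h ] (x ≡ h + h ⊎ x ≡ suc (h + h))
even-or-odd zero = 0 , inj₁ refl
even-or-odd (suc x) with even-or-odd x
... | h , inj₁ refl = h , inj₂ refl
... | h , inj₂ refl = suc h , inj₁ (cong suc (sym (+-suc h h)))

CycleDAntimagic-cast : ∀ {m n} .{{_ : NonZero m}} .{{_ : NonZero n}} {D} →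
  m ≡ n → CycleDAntimagic m D → CycleDAntimagic n D
CycleDAntimagic-cast refl antimagic = antimagic

mainTheorem18 : (n : ℕ) → .{{_ : NonZero n}} → 4 ≤ n → n ≢ 6 →
    CycleDAntimagic n (0 ∷ 3 ∷ [])
mainTheorem18 .(4 + r) (s≤s (s≤s (s≤s (s≤s {n = r} _)))) 4+r≢6 with even-or-odd r
... | j , inj₂ refl = OddLength.antimagic j
... | 0 , inj₁ refl = SmallLengths.cycle4
... | 1 , inj₁ refl = contradiction refl 4+r≢6
... | 2 , inj₁ refl = SmallLengths.cycle8
... | 3 , inj₁ refl = SmallLengths.cycle10
... | 4 , inj₁ refl = SmallLengths.cycle12
... | suc (suc (suc (suc (suc j)))) , inj₁ refl =
  CycleDAntimagic-cast (cong (4 +_) (sym ([m+o]+[n+o]≡m+n+[o+o] 5 5 j))) (EvenLength.antimagic j)
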